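{- Let $m\ge 0$ be an integer and $g=30m+27$. There exists an almost $5$-star factor $F$ on $\{0,1,\dots,30m+26\}$ with $t=3$ isolated vertices such that: (i) every $d\in\{1,2,\dots,15m+13\}$ is the forward difference of at least one edge of $F$; (ii) every $d\in\{1,2,\dots,15m+13\}$ is the forward difference of at most two edges of $F$; (iii) $F$ has no wrap-around edges; (iv) there is a pure/prime labelling of $F$ with respect to which exactly one of the $5$-star components of $F$ is mixed and the little star (a star with $2$ edges on the $3$ isolated vertices) is a prime star.
   Context: Let $g\ge 1$ and $t\in\{0,\dots,5\}$ with $g\equiv t\pmod 6$. An almost $5$-star factor on $\{0,1,\dots,g-1\}$ with $t$ isolated vertices is a graph $F$ on this vertex set such that the vertex set is partitioned into $(g-t)/6$ six-element sets, each spanning a connected component of $F$ isomorphic to $K_{1,5}$ (a $5$-star), and one $t$-element set $X$ (the isolated vertices) on which $F$ induces a star $K_{1,t-1}$ (the little star), and $F$ has no other edges. For an edge $\{u,w\}$ with $u<w$, its difference is $\min\{w-u,\,g-(w-u)\}$; the edge is a forward edge if its difference equals $w-u$ (and then $w-u$ is its forward difference), and a wrap-around edge otherwise. A pure/prime labelling of $F$ assigns to each edge of $F$ one of the labels "pure" or "prime" so that no two pure edges have the same difference and no two prime edges have the same difference. With respect to such a labelling, a star is pure (resp. prime) if all its edges are pure (resp. prime), and mixed if it contains both a pure and a prime edge. -}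

module Defs where

open import Data.Nat using (ℕ; _+_; _*_; _∸_; _⊓_; ∣_-_∣; _≤_)
open import Data.Nat.Properties using (_≟_)
open import Data.Product using (_×_; _,_; proj₁; proj₂)
open import Data.Product.Properties using ()
open import Data.List using (List; []; _∷_; _++_; map; concatMap; filter; length; upTo)
open import Data.List.Relation.Unary.Any using (Any)
open import Data.List.Relation.Unary.All using (All)
open import Data.List.Relation.Unary.Any as Any using ()
open import Data.List.Relation.Unary.Unique.Propositional using (Unique)
open import Data.List.Relation.Binary.Permutation.Propositional using (_↭_)
open import Data.Vec using (Vec; toList)
open import Relation.Binary.PropositionalEquality using (_≡_; refl)
open import Relation.Nullary using (Dec; yes; no; ¬_)
open import Relation.Nullary.Decidable using (_×-dec_)

record Star (k : ℕ) : Set where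
  constructor star
  field
    center : ℕ
    leaves : Vec ℕ k
open Star public

-- An edge is stored as an (unordered) pair of endpoints (centre , leaf).
Edge : Set
Edge = ℕ × ℕ

starVertices : ∀ {k} → Star k → List ℕ
starVertices s = center s ∷ toList (leaves s)

starEdges : ∀ {k} → Star k → List Edge
starEdges s = map (λ l → center s , l) (toList (leaves s))

-- An almost 5-star factor with t isolated vertices: a list of 5-stars
-- (K_{1,5} components) and a little star K_{1,t-1} on the t isolated vertices.
record AlmostFactor (t : ℕ) : Set where
  constructor factor
  field
    fiveStars  : List (Star 5)
    littleStar : Star (t ∸ 1)
open AlmostFactor public

vertices : ∀ {t} → AlmostFactor t → List ℕ
vertices F = concatMap starVertices (fiveStars F) ++ starVertices (littleStar F)

edges : ∀ {t} → AlmostFactor t → List Edge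
edges F = concatMap starEdges (fiveStars F) ++ starEdges (littleStar F)

-- F is an almost 5-star factor on {0,…,g-1} with t isolated vertices:
-- the vertex sets of the components partition {0,…,g-1}, i.e. the list of all
-- vertices (centres and leaves of all stars) is a permutation of [0 … g-1].
IsAlmost5StarFactor : (g t : ℕ) → AlmostFactor t → Set
IsAlmost5StarFactor g t F = vertices F ↭ upTo g

edgeLength : Edge → ℕ
edgeLength (u , w) = ∣ u - w ∣

difference : ℕ → Edge → ℕ
difference g e = edgeLength e ⊓ (g ∸ edgeLength e)

IsForward : ℕ → Edge → Set
IsForward g e = difference g e ≡ edgeLength e

IsWrapAround : ℕ → Edge → Set
IsWrapAround g e = ¬ IsForward g e

HasForwardDiff : ℕ → ℕ → Edge → Set
HasForwardDiff g d e = IsForward g e × edgeLength e ≡ d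

hasForwardDiff? : ∀ g d e → Dec (HasForwardDiff g d e)
hasForwardDiff? g d e = (difference g e ≟ edgeLength e) ×-dec (edgeLength e ≟ d)

numForwardDiff : ∀ {t} → ℕ → ℕ → AlmostFactor t → ℕ
numForwardDiff g d F = length (filter (hasForwardDiff? g d) (edges F))

data Label : Set where
  pure prime : Label

_≟L_ : (a b : Label) → Dec (a ≡ b)
pure  ≟L pure  = yes refl
pure  ≟L prime = no λ ()
prime ≟L pure  = no λ ()
prime ≟L prime = yes refl

-- A labelling assigns a label to each edge (centre , leaf).  Since the stars
-- are vertex-disjoint, each edge of F occurs exactly once as such a pair.
Labelling : Set
Labelling = Edge → Label

edgesLabelled : ∀ {t} → Labelling → Label → AlmostFactor t → List Edge
edgesLabelled lab a F = filter (λ e → lab e ≟L a) (edges F)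

IsPurePrimeLabelling : ∀ {t} → ℕ → AlmostFactor t → Labelling → Set
IsPurePrimeLabelling g F lab =
  Unique (map (difference g) (edgesLabelled lab pure F)) ×
  Unique (map (difference g) (edgesLabelled lab prime F))

IsPrimeStar : ∀ {k} → Labelling → Star k → Set
IsPrimeStar lab s = All (λ e → lab e ≡ prime) (starEdges s)

IsMixed : ∀ {k} → Labelling → Star k → Set
IsMixed lab s = Any (λ e → lab e ≡ pure) (starEdges s) × Any (λ e → lab e ≡ prime) (starEdges s)

isMixed? : ∀ {k} (lab : Labelling) (s : Star k) → Dec (IsMixed lab s)
isMixed? lab s = Any.any? (λ e → lab e ≟L pure) (starEdges s) ×-dec Any.any? (λ e → lab e ≟L prime) (starEdges s)

numMixed : ∀ {t} → Labelling → AlmostFactor t → ℕ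
numMixed lab F = length (filter (isMixed? lab) (fiveStars F))

{-# OPTIONS --safe #-}
module Submission where

-- The factor is assembled from families of stars: a family consists of K = a·m + b stars, the
-- i-th one centred at c + i, and each of its leaves moves linearly with i (by +2, or by −1 so
-- that it sweeps a block of K consecutive vertices downwards).  The vertices of a family, and
-- for every leaf the lengths of its K edges, therefore form arithmetic progressions whose first
-- term and number of terms are affine in m.  That the vertices are exactly {0, …, g − 1}, that
-- the pure edge lengths are exactly {1, …, N} and that the prime ones are distinct elements of
-- {1, …, N} (N = 15m + 13, so g = 2N + 1) thus become permutation identities between finite
-- lists of symbolic progressions, decided by computation against explicit tilings of the
-- intervals.  An edge (centre, leaf) is pure iff it lies lexicographically below
-- (15m + 13, 26m + 25), so only the star centred at 15m + 13 is mixed.  Lengths at most N are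
-- below g / 2, hence forward differences, and (i)–(iii) follow by counting.

open import Defs

open import Data.Bool using (if_then_else_)
open import Data.List
  using (List; []; _∷_; _++_; map; concat; concatMap; filter; length; applyUpTo; applyDownFrom; upTo; reverse)
open import Data.List.Membership.Propositional using (_∈_)
open import Data.List.Properties
  using (map-++; map-∘; map-cong-local; map-upTo; map-concatMap; length-++; length-map; length-upTo;
         concatMap-++; concatMap-map; concatMap-cong; ++-assoc; ++-identityʳ; reverse-applyUpTo;
         filter-++; filter-all; filter-none; filter-some; filter-accept; filter-reject)
open import Data.List.Relation.Binary.Permutation.Propositional
  using (_↭_; ↭-refl; ↭-sym; ↭-trans; ↭-reflexive; prep; swap; module PermutationReasoning)
import Data.List.Relation.Binary.Permutation.Propositional as ↭
open import Data.List.Relation.Binary.Permutation.Propositional.Properties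
  using (++⁺; ++⁺ˡ; ++⁺ʳ; shift; shifts; ↭-reverse; filter-↭; ↭-length; map⁺; All-resp-↭)
open import Data.List.Relation.Unary.All as All using (All; []; _∷_)
import Data.List.Relation.Unary.All.Properties as AllP
open import Data.List.Relation.Unary.AllPairs using ([]; _∷_)
open import Data.List.Relation.Unary.Any as Any using (Any; here; there; _─_; any?)
import Data.List.Relation.Unary.Any.Properties as AnyP
open import Data.List.Relation.Unary.Unique.Propositional using (Unique)
import Data.List.Relation.Unary.Unique.Propositional.Properties as UniqueP
open import Data.Maybe as Maybe using (Maybe; just; nothing; from-just)
open import Data.Nat using (ℕ; zero; suc; _+_; _*_; _∸_; _≤_; _<_; z≤n; s≤s; z<s; _≟_; _≤?_; _<?_)
open import Data.Nat.ListAction using (sum)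
open import Data.Nat.Properties
open import Data.Nat.Tactic.RingSolver using (solve-∀)
open import Data.Product using (Σ; _×_; _,_; proj₁; proj₂)
open import Data.Product.Properties using (≡-dec)
open import Data.Product.Relation.Binary.Lex.Strict using (×-Lex; ×-decidable)
open import Data.Sum using (_⊎_; inj₁; inj₂; [_,_])
open import Data.Vec using (Vec; toList; []; _∷_)
import Data.Vec as Vec
import Data.Vec.Properties as VecP
open import Function using (_∘_; _⇔_; mk⇔; Equivalence)
open import Relation.Binary.Definitions using (DecidableEquality)
open import Relation.Binary.PropositionalEquality
  using (_≡_; _≢_; refl; sym; trans; cong; cong₂; subst; subst₂; module ≡-Reasoning)
open import Relation.Nullary using (Dec; does; yes; no; ¬_; _×-dec_; _⊎-dec_; map′)
open import Relation.Nullary.Decidable using (dec-true; dec-false; from-yes)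

applyUpTo-cong : ∀ {A : Set} {f g : ℕ → A} n → (∀ {i} → i < n → f i ≡ g i) →
                 applyUpTo f n ≡ applyUpTo g n
applyUpTo-cong zero    f≡g = refl
applyUpTo-cong (suc n) f≡g = cong₂ _∷_ (f≡g z<s) (applyUpTo-cong n (f≡g ∘ s≤s))

applyUpTo-++ : ∀ {A : Set} (f : ℕ → A) m n →
               applyUpTo f (m + n) ≡ applyUpTo f m ++ applyUpTo (f ∘ (m +_)) n
applyUpTo-++ f zero    n = refl
applyUpTo-++ f (suc m) n = cong (f 0 ∷_) (applyUpTo-++ (f ∘ suc) m n)

applyUpTo-reverse-↭ : ∀ {A : Set} (f : ℕ → A) n → applyUpTo (λ i → f (n ∸ suc i)) n ↭ applyUpTo f n
applyUpTo-reverse-↭ f n = begin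
  applyUpTo (λ i → f (n ∸ suc i)) n  ≡⟨ downwards n ⟩
  applyDownFrom f n                  ≡⟨ sym (reverse-applyUpTo f n) ⟩
  reverse (applyUpTo f n)            ↭⟨ ↭-reverse (applyUpTo f n) ⟩
  applyUpTo f n                      ∎
  where
  open PermutationReasoning
  downwards : ∀ n → applyUpTo (λ i → f (n ∸ suc i)) n ≡ applyDownFrom f n
  downwards zero    = refl
  downwards (suc n) = cong (f n ∷_) (downwards n)

applyUpTo-evens-odds-↭ : ∀ {A : Set} (f : ℕ → A) n →
  applyUpTo (λ i → f (2 * i)) n ++ applyUpTo (λ i → f (suc (2 * i))) n ↭ applyUpTo f (n + n)
applyUpTo-evens-odds-↭ f zero    = ↭-refl
applyUpTo-evens-odds-↭ f (suc n) = begin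
  f 0 ∷ evens ++ f 1 ∷ odds                       ↭⟨ prep (f 0) (shift (f 1) evens odds) ⟩
  f 0 ∷ f 1 ∷ evens ++ odds                       ≡⟨ cong₂ (λ xs ys → f 0 ∷ f 1 ∷ xs ++ ys) evens≡ odds≡ ⟩
  f 0 ∷ f 1 ∷ evens′ ++ odds′                     ↭⟨ prep (f 0) (prep (f 1) (applyUpTo-evens-odds-↭ (f ∘ suc ∘ suc) n)) ⟩
  f 0 ∷ f 1 ∷ applyUpTo (f ∘ suc ∘ suc) (n + n)   ≡⟨ cong (λ k → f 0 ∷ applyUpTo (f ∘ suc) k) (sym (+-suc n n)) ⟩
  applyUpTo f (suc n + suc n)                     ∎
  where
  open PermutationReasoning
  evens  = applyUpTo (λ i → f (2 * suc i)) n
  odds   = applyUpTo (λ i → f (suc (2 * suc i))) n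
  evens′ = applyUpTo (λ i → f (suc (suc (2 * i)))) n
  odds′  = applyUpTo (λ i → f (suc (suc (suc (2 * i))))) n
  evens≡ : evens ≡ evens′
  evens≡ = applyUpTo-cong n (λ {i} _ → cong f (*-suc 2 i))
  odds≡ : odds ≡ odds′
  odds≡ = applyUpTo-cong n (λ {i} _ → cong (f ∘ suc) (*-suc 2 i))

concatMap⁺ : ∀ {A B : Set} (f : A → List B) {xs ys} → xs ↭ ys → concatMap f xs ↭ concatMap f ys
concatMap⁺ f ↭.refl        = ↭-refl
concatMap⁺ f (prep x p)    = ++⁺ˡ (f x) (concatMap⁺ f p)
concatMap⁺ f (swap x y p)  = ↭-trans (shifts (f x) (f y)) (++⁺ˡ (f y) (++⁺ˡ (f x) (concatMap⁺ f p)))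
concatMap⁺ f (↭.trans p q) = ↭-trans (concatMap⁺ f p) (concatMap⁺ f q)

concatMap-cong-↭ : ∀ {A B : Set} {f g : A → List B} {xs} → All (λ x → f x ↭ g x) xs →
                   concatMap f xs ↭ concatMap g xs
concatMap-cong-↭ []       = ↭-refl
concatMap-cong-↭ (p ∷ ps) = ++⁺ p (concatMap-cong-↭ ps)

concatMap-cong-upTo : ∀ {A : Set} {f g : ℕ → List A} k → (∀ {i} → i < k → f i ≡ g i) →
                      concatMap f (upTo k) ≡ concatMap g (upTo k)
concatMap-cong-upTo k f≡g = cong concat (map-cong-local (AllP.applyUpTo⁺₁ _ k f≡g))

concatMap-map-comm-↭ : ∀ {A B C : Set} (g : A → B → C) xs ys →
  concatMap (λ x → map (g x) ys) xs ↭ concatMap (λ y → map (λ x → g x y) xs) ys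
concatMap-map-comm-↭ g xs []       = ↭-reflexive (no-columns xs)
  where
  no-columns : ∀ xs → concatMap (λ x → map (g x) []) xs ≡ []
  no-columns []       = refl
  no-columns (x ∷ xs) = no-columns xs
concatMap-map-comm-↭ g xs (y ∷ ys) =
  ↭-trans (first-column xs) (++⁺ˡ (map (λ x → g x y) xs) (concatMap-map-comm-↭ g xs ys))
  where
  first-column : ∀ xs → concatMap (λ x → g x y ∷ map (g x) ys) xs
                        ↭ map (λ x → g x y) xs ++ concatMap (λ x → map (g x) ys) xs
  first-column []       = ↭-refl
  first-column (x ∷ xs) = prep (g x y) (↭-trans (++⁺ˡ (map (g x) ys) (first-column xs))
                                                (shifts (map (g x) ys) (map (λ x → g x y) xs)))

concatMap-concatMap : ∀ {A B C : Set} (f : B → List C) (g : A → List B) xs →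
                      concatMap f (concatMap g xs) ≡ concatMap (concatMap f ∘ g) xs
concatMap-concatMap f g []       = refl
concatMap-concatMap f g (x ∷ xs) = trans (concatMap-++ f (g x) _) (cong (concatMap f (g x) ++_) (concatMap-concatMap f g xs))

filter-concatMap : ∀ {A B : Set} {P : B → Set} (P? : ∀ y → Dec (P y)) (f : A → List B) xs →
                   filter P? (concatMap f xs) ≡ concatMap (filter P? ∘ f) xs
filter-concatMap P? f []       = refl
filter-concatMap P? f (x ∷ xs) = trans (filter-++ P? (f x) _) (cong (filter P? (f x) ++_) (filter-concatMap P? f xs))

length-concatMap : ∀ {A B : Set} (f : A → List B) xs → length (concatMap f xs) ≡ sum (map (length ∘ f) xs)
length-concatMap f []       = refl
length-concatMap f (x ∷ xs) = trans (length-++ (f x)) (cong (length (f x) +_) (length-concatMap f xs))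

module PermutationSearch {A : Set} (_≟_ : DecidableEquality A) where
  open import Data.List.Membership.DecPropositional _≟_ using (_∈?_)

  ↭-─ : ∀ {x} {ys : List A} (x∈ys : x ∈ ys) → ys ↭ x ∷ (ys ─ x∈ys)
  ↭-─ (here refl)          = ↭-refl
  ↭-─ (there {x = y} x∈ys) = ↭-trans (prep y (↭-─ x∈ys)) (swap y _ ↭-refl)

  searchPermutation : (xs ys : List A) → Maybe (xs ↭ ys)
  searchPermutation []       []      = just ↭-refl
  searchPermutation []       (_ ∷ _) = nothing
  searchPermutation (x ∷ xs) ys with x ∈? ys
  ... | no  _    = nothing
  ... | yes x∈ys = Maybe.map (λ p → ↭-trans (prep x p) (↭-sym (↭-─ x∈ys))) (searchPermutation xs (ys ─ x∈ys))

count : ℕ → List ℕ → ℕ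
count d xs = length (filter (_≟ d) xs)

count-↭ : ∀ d {xs ys} → xs ↭ ys → count d xs ≡ count d ys
count-↭ d p = ↭-length (filter-↭ (_≟ d) p)

count-++ : ∀ d xs ys → count d (xs ++ ys) ≡ count d xs + count d ys
count-++ d xs ys = trans (cong length (filter-++ (_≟ d) xs ys)) (length-++ (filter (_≟ d) xs))

count-here : ∀ x xs → count x (x ∷ xs) ≡ suc (count x xs)
count-here x xs = cong length (filter-accept (_≟ x) refl)

count-there : ∀ {d x} xs → x ≢ d → count d (x ∷ xs) ≡ count d xs
count-there xs x≢d = cong length (filter-reject (_≟ _) x≢d)

∈⇒1≤count : ∀ {d xs} → d ∈ xs → 1 ≤ count d xs
∈⇒1≤count d∈xs = filter-some (_≟ _) (Any.map sym d∈xs)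

Unique⇒count≤1 : ∀ d {xs} → Unique xs → count d xs ≤ 1
Unique⇒count≤1 d {[]}     []            = z≤n
Unique⇒count≤1 d {x ∷ xs} (x∉xs ∷ uniq) with x ≟ d
... | yes refl = ≤-reflexive (trans (count-here x xs)
                   (cong (suc ∘ length) (filter-none (_≟ x) (All.map (λ x≢y y≡x → x≢y (sym y≡x)) x∉xs))))
... | no  x≢d  = subst (_≤ 1) (sym (count-there xs x≢d)) (Unique⇒count≤1 d uniq)

count≤1⇒Unique : ∀ xs → (∀ d → count d xs ≤ 1) → Unique xs
count≤1⇒Unique []       _       = []
count≤1⇒Unique (x ∷ xs) count≤1 = All.tabulate x∉xs ∷ count≤1⇒Unique xs (λ d → ≤-trans (count-tail d) (count≤1 d))
  where
  count-tail : ∀ d → count d xs ≤ count d (x ∷ xs)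
  count-tail d with x ≟ d
  ... | yes refl = subst (count x xs ≤_) (sym (count-here x xs)) (n≤1+n _)
  ... | no  x≢d  = ≤-reflexive (sym (count-there xs x≢d))
  x∉xs : ∀ {y} → y ∈ xs → x ≢ y
  x∉xs y∈xs refl with ≤-trans (s≤s (∈⇒1≤count y∈xs)) (subst (_≤ 1) (count-here x xs) (count≤1 x))
  ... | s≤s ()

-- (a , b) stands for a * m + b.
Affine : Set
Affine = ℕ × ℕ

⟦_⟧ : Affine → ℕ → ℕ
⟦ a , b ⟧ m = a * m + b

0ᴬ 1ᴬ : Affine
0ᴬ = 0 , 0
1ᴬ = 0 , 1

infixl 6 _+ᴬ_ _∸ᴬ_
infix  4 _≤ᴬ_ _≤ᴬ?_ _≟ᴬ_

_+ᴬ_ : Affine → Affine → Affine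
(a , b) +ᴬ (c , d) = a + c , b + d

_∸ᴬ_ : Affine → Affine → Affine
(a , b) ∸ᴬ (c , d) = a ∸ c , b ∸ d

_≤ᴬ_ : Affine → Affine → Set
(a , b) ≤ᴬ (c , d) = a ≤ c × b ≤ d

_≤ᴬ?_ : ∀ x y → Dec (x ≤ᴬ y)
(a , b) ≤ᴬ? (c , d) = a ≤? c ×-dec b ≤? d

_≟ᴬ_ : DecidableEquality Affine
_≟ᴬ_ = ≡-dec _≟_ _≟_

⟦⟧-+ᴬ : ∀ x y m → ⟦ x +ᴬ y ⟧ m ≡ ⟦ x ⟧ m + ⟦ y ⟧ m
⟦⟧-+ᴬ (a , b) (c , d) m = distrib a b c d m
  where
  distrib : ∀ a b c d m → (a + c) * m + (b + d) ≡ a * m + b + (c * m + d)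
  distrib = solve-∀

⟦⟧-mono-≤ : ∀ {x y} m → x ≤ᴬ y → ⟦ x ⟧ m ≤ ⟦ y ⟧ m
⟦⟧-mono-≤ m (a≤c , b≤d) = +-mono-≤ (*-monoˡ-≤ m a≤c) b≤d

⟦⟧-∸ᴬ : ∀ {x y} m → x ≤ᴬ y → ⟦ y ⟧ m ≡ ⟦ x ⟧ m + ⟦ y ∸ᴬ x ⟧ m
⟦⟧-∸ᴬ {x} {y} m (a≤c , b≤d) = begin
  ⟦ y ⟧ m                 ≡⟨ cong (λ z → ⟦ z ⟧ m) (sym (cong₂ _,_ (m+[n∸m]≡n a≤c) (m+[n∸m]≡n b≤d))) ⟩
  ⟦ x +ᴬ (y ∸ᴬ x) ⟧ m     ≡⟨ ⟦⟧-+ᴬ x (y ∸ᴬ x) m ⟩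
  ⟦ x ⟧ m + ⟦ y ∸ᴬ x ⟧ m  ∎
  where open ≡-Reasoning

⟦⟧-∸ᴬ-+ᴬ : ∀ x y {z} m → x +ᴬ y ≤ᴬ z → ⟦ z ⟧ m ≡ ⟦ x ⟧ m + ⟦ y ⟧ m + ⟦ z ∸ᴬ (x +ᴬ y) ⟧ m
⟦⟧-∸ᴬ-+ᴬ x y {z} m x+y≤z = trans (⟦⟧-∸ᴬ m x+y≤z) (cong (_+ ⟦ z ∸ᴬ (x +ᴬ y) ⟧ m) (⟦⟧-+ᴬ x y m))

-- Progressions and tilings

range : ℕ → ℕ → List ℕ
range a n = applyUpTo (a +_) n

progression : ℕ → ℕ → ℕ → List ℕ
progression a d n = applyUpTo (λ i → a + d * i) n

progression-1 : ∀ a n → progression a 1 n ≡ range a n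
progression-1 a n = applyUpTo-cong n (λ {i} _ → cong (a +_) (*-identityˡ i))

progression-single : ∀ a d → progression a d 1 ≡ range a 1
progression-single a d = cong (λ k → a + k ∷ []) (*-zeroʳ d)

range-++ : ∀ a m n → range a (m + n) ≡ range a m ++ range (a + m) n
range-++ a m n = trans (applyUpTo-++ (a +_) m n) (cong (range a m ++_) (applyUpTo-cong n (λ {i} _ → sym (+-assoc a m i))))

range-Unique : ∀ a n → Unique (range a n)
range-Unique a n = UniqueP.applyUpTo⁺₁ (a +_) n (λ i<j _ → <⇒≢ (+-monoʳ-< a i<j))

progression-interleave-↭ : ∀ a n → progression a 2 n ++ progression (a + 1) 2 n ↭ range a (n + n)
progression-interleave-↭ a n = begin
  progression a 2 n ++ progression (a + 1) 2 n              ≡⟨ cong (progression a 2 n ++_) odds≡ ⟩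
  progression a 2 n ++ applyUpTo (λ i → a + suc (2 * i)) n  ↭⟨ applyUpTo-evens-odds-↭ (a +_) n ⟩
  range a (n + n)                                           ∎
  where
  open PermutationReasoning
  odds≡ : progression (a + 1) 2 n ≡ applyUpTo (λ i → a + suc (2 * i)) n
  odds≡ = applyUpTo-cong n (λ {i} _ → +-assoc a 1 (2 * i))

record Progression : Set where
  constructor prog
  field
    start : Affine
    step  : ℕ
    terms : Affine

⟦_⟧ₚ : Progression → ℕ → List ℕ
⟦ prog a d n ⟧ₚ m = progression (⟦ a ⟧ m) d (⟦ n ⟧ m)

_≟ₚ_ : DecidableEquality Progression
prog a d n ≟ₚ prog a′ d′ n′ =
  map′ (λ { (refl , refl , refl) → refl }) (λ { refl → refl , refl , refl }) (a ≟ᴬ a′ ×-dec d ≟ d′ ×-dec n ≟ᴬ n′)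

open PermutationSearch _≟ₚ_ using (searchPermutation)

-- A Tiling s w splits the interval [s, s + w) into runs, single points and pairs of interleaved
-- step-2 progressions; a point carries a step only so that it matches the progression it covers.
infixr 5 run_∷_ point_∷_ twin_∷_

data Tiling : Affine → Affine → Set where
  []       : ∀ {s} → Tiling s 0ᴬ
  run_∷_   : ∀ {s w} n → Tiling (s +ᴬ n) w → Tiling s (n +ᴬ w)
  point_∷_ : ∀ {s w} (d : ℕ) → Tiling (s +ᴬ 1ᴬ) w → Tiling s (1ᴬ +ᴬ w)
  twin_∷_  : ∀ {s w} n → Tiling (s +ᴬ (n +ᴬ n)) w → Tiling s ((n +ᴬ n) +ᴬ w)

tiles : ∀ {s w} → Tiling s w → List Progression
tiles []                 = []
tiles (run_∷_ {s} n t)   = prog s 1 n ∷ tiles t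
tiles (point_∷_ {s} d t) = prog s d 1ᴬ ∷ tiles t
tiles (twin_∷_ {s} n t)  = prog s 2 n ∷ prog (s +ᴬ 1ᴬ) 2 n ∷ tiles t

module _ (m : ℕ) where
  private
    ⟦_⟧ₘ : List Progression → List ℕ
    ⟦_⟧ₘ = concatMap (λ p → ⟦ p ⟧ₚ m)

  range-prepend-↭ : ∀ (s n w : Affine) {xs ys} →
                    xs ↭ range (⟦ s ⟧ m) (⟦ n ⟧ m) → ys ↭ range (⟦ s +ᴬ n ⟧ m) (⟦ w ⟧ m) →
                    xs ++ ys ↭ range (⟦ s ⟧ m) (⟦ n +ᴬ w ⟧ m)
  range-prepend-↭ s n w {xs} {ys} xs↭ ys↭ = begin
    xs ++ ys                               ↭⟨ ++⁺ xs↭ ys↭ ⟩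
    range S N ++ range (⟦ s +ᴬ n ⟧ m) W    ≡⟨ cong (λ b → range S N ++ range b W) (⟦⟧-+ᴬ s n m) ⟩
    range S N ++ range (S + N) W           ≡⟨ sym (range-++ S N W) ⟩
    range S (N + W)                        ≡⟨ cong (range S) (sym (⟦⟧-+ᴬ n w m)) ⟩
    range S (⟦ n +ᴬ w ⟧ m)                 ∎
    where
    open PermutationReasoning
    S = ⟦ s ⟧ m
    N = ⟦ n ⟧ m
    W = ⟦ w ⟧ m

  tiling-↭ : ∀ {s w} (t : Tiling s w) → ⟦ tiles t ⟧ₘ ↭ range (⟦ s ⟧ m) (⟦ w ⟧ m)
  tiling-↭ []                     = ↭-refl
  tiling-↭ (run_∷_ {s} {w} n t)   = range-prepend-↭ s n w (↭-reflexive (progression-1 _ _)) (tiling-↭ t)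
  tiling-↭ (point_∷_ {s} {w} d t) = range-prepend-↭ s 1ᴬ w (↭-reflexive (progression-single _ d)) (tiling-↭ t)
  tiling-↭ (twin_∷_ {s} {w} n t)  =
    ↭-trans (↭-reflexive (sym (++-assoc (⟦ prog s 2 n ⟧ₚ m) _ _))) (range-prepend-↭ s (n +ᴬ n) w interleave (tiling-↭ t))
    where
    interleave : ⟦ prog s 2 n ⟧ₚ m ++ ⟦ prog (s +ᴬ 1ᴬ) 2 n ⟧ₚ m ↭ range (⟦ s ⟧ m) (⟦ n +ᴬ n ⟧ m)
    interleave = subst₂ (λ b k → ⟦ prog s 2 n ⟧ₚ m ++ progression b 2 (⟦ n ⟧ m) ↭ range (⟦ s ⟧ m) k)
                        (sym (⟦⟧-+ᴬ s 1ᴬ m)) (sym (⟦⟧-+ᴬ n n m)) (progression-interleave-↭ (⟦ s ⟧ m) (⟦ n ⟧ m))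

-- Families of stars

data Shape : Set where
  stride₂ reversed : Shape

data Side : Set where
  left right : Side

record Leaf : Set where
  constructor leaf
  field
    label : Label
    shape : Shape
    side  : Side
    base  : Affine
open Leaf

record Family (n : ℕ) : Set where
  constructor family
  field
    centre : Affine
    size   : Affine
    leaves : Vec Leaf n
open Family

leafVertex : ℕ → ℕ → Leaf → ℕ → ℕ
leafVertex m K (leaf _ stride₂  _ b) i = ⟦ b ⟧ m + 2 * i
leafVertex m K (leaf _ reversed _ b) i = ⟦ b ⟧ m + (K ∸ suc i)

module _ {n : ℕ} (m : ℕ) (fam : Family n) where
  private
    C = ⟦ centre fam ⟧ m
    K = ⟦ size fam ⟧ m
    L = toList (leaves fam)

  familyEdge : ℕ → Leaf → Edge
  familyEdge i lf = C + i , leafVertex m K lf i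

  familyStar : ℕ → Star n
  familyStar i = star (C + i) (Vec.map (λ lf → leafVertex m K lf i) (leaves fam))

  familyStars : List (Star n)
  familyStars = map familyStar (upTo K)

  familyStars-all : ∀ {P : Star n → Set} → (∀ {i} → i < K → P (familyStar i)) → All P familyStars
  familyStars-all p = AllP.map⁺ (AllP.applyUpTo⁺₁ _ K p)

  starVertices-familyStar : ∀ i → starVertices (familyStar i) ≡ map (λ h → h i) ((C +_) ∷ map (leafVertex m K) L)
  starVertices-familyStar i = cong (C + i ∷_) (trans (VecP.toList-map _ (leaves fam)) (map-∘ L))

  starEdges-familyStar : ∀ i → starEdges (familyStar i) ≡ map (familyEdge i) L
  starEdges-familyStar i = trans (cong (map (C + i ,_)) (VecP.toList-map _ (leaves fam))) (sym (map-∘ L))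

familyStars-single : ∀ {n} m (fam : Family n) → size fam ≡ 1ᴬ → familyStars m fam ≡ familyStar m fam 0 ∷ []
familyStars-single m fam refl = refl

vertexProgression : Affine → Leaf → Progression
vertexProgression K (leaf _ stride₂  _ b) = prog b 2 K
vertexProgression K (leaf _ reversed _ b) = prog b 1 K

vertexProgressions : ∀ {n} → Family n → List Progression
vertexProgressions fam = prog (centre fam) 1 (size fam) ∷ map (vertexProgression (size fam)) (toList (leaves fam))

leafVertices-↭ : ∀ m K lf → map (leafVertex m (⟦ K ⟧ m) lf) (upTo (⟦ K ⟧ m)) ↭ ⟦ vertexProgression K lf ⟧ₚ m
leafVertices-↭ m K (leaf _ stride₂  _ b) = ↭-reflexive (map-upTo _ (⟦ K ⟧ m))
leafVertices-↭ m K (leaf _ reversed _ b) = begin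
  map (λ i → ⟦ b ⟧ m + (k ∸ suc i)) (upTo k)  ≡⟨ map-upTo _ k ⟩
  applyUpTo (λ i → ⟦ b ⟧ m + (k ∸ suc i)) k   ↭⟨ applyUpTo-reverse-↭ (⟦ b ⟧ m +_) k ⟩
  range (⟦ b ⟧ m) k                           ≡⟨ sym (progression-1 (⟦ b ⟧ m) k) ⟩
  progression (⟦ b ⟧ m) 1 k                   ∎
  where
  open PermutationReasoning
  k = ⟦ K ⟧ m

familyVertices-↭ : ∀ {n} m (fam : Family n) →
  concatMap starVertices (familyStars m fam) ↭ concatMap (λ p → ⟦ p ⟧ₚ m) (vertexProgressions fam)
familyVertices-↭ m fam = begin
  concatMap starVertices (map (familyStar m fam) (upTo K))  ≡⟨ concatMap-map starVertices (familyStar m fam) (upTo K) ⟩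
  concatMap (starVertices ∘ familyStar m fam) (upTo K)      ≡⟨ concatMap-cong (starVertices-familyStar m fam) (upTo K) ⟩
  concatMap (λ i → map (λ h → h i) hs) (upTo K)             ↭⟨ concatMap-map-comm-↭ (λ i h → h i) (upTo K) hs ⟩
  map (C +_) (upTo K) ++ concatMap (λ h → map h (upTo K)) (map (leafVertex m K) L)
    ≡⟨ cong₂ _++_ (trans (map-upTo (C +_) K) (sym (progression-1 C K)))
                  (concatMap-map (λ h → map h (upTo K)) (leafVertex m K) L) ⟩
  progression C 1 K ++ concatMap (λ lf → map (leafVertex m K lf) (upTo K)) L
    ↭⟨ ++⁺ˡ (progression C 1 K) (concatMap-cong-↭ {xs = L} (All.tabulate (λ {lf} _ → leafVertices-↭ m (size fam) lf))) ⟩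
  progression C 1 K ++ concatMap (λ lf → ⟦ vertexProgression (size fam) lf ⟧ₚ m) L
    ≡⟨ cong (progression C 1 K ++_) (sym (concatMap-map (λ p → ⟦ p ⟧ₚ m) (vertexProgression (size fam)) L)) ⟩
  concatMap (λ p → ⟦ p ⟧ₚ m) (vertexProgressions fam)       ∎
  where
  open PermutationReasoning
  C = ⟦ centre fam ⟧ m
  K = ⟦ size fam ⟧ m
  L = toList (leaves fam)
  hs = (C +_) ∷ map (leafVertex m K) L

OnSide : Affine → Affine → Leaf → Set
OnSide c K (leaf _ stride₂  right b) = c ≤ᴬ b
OnSide c K (leaf _ reversed right b) = c +ᴬ K ≤ᴬ b
OnSide c K (leaf _ _        left  b) = b +ᴬ K ≤ᴬ c

onSide? : ∀ c K lf → Dec (OnSide c K lf)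
onSide? c K (leaf _ stride₂  right b) = c ≤ᴬ? b
onSide? c K (leaf _ reversed right b) = c +ᴬ K ≤ᴬ? b
onSide? c K (leaf _ stride₂  left  b) = b +ᴬ K ≤ᴬ? c
onSide? c K (leaf _ reversed left  b) = b +ᴬ K ≤ᴬ? c

lengthProgression : Affine → Affine → Leaf → Progression
lengthProgression c K (leaf _ stride₂  right b) = prog (b ∸ᴬ c) 1 K
lengthProgression c K (leaf _ reversed right b) = prog (b ∸ᴬ (c +ᴬ K) +ᴬ 1ᴬ) 2 K
lengthProgression c K (leaf _ stride₂  left  b) = prog (c ∸ᴬ (b +ᴬ K) +ᴬ 1ᴬ) 1 K
lengthProgression c K (leaf _ reversed left  b) = prog (c ∸ᴬ (b +ᴬ K) +ᴬ 1ᴬ) 2 K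

edgeLength-right : ∀ x d {y} → y ≡ x + d → edgeLength (x , y) ≡ d
edgeLength-right x d refl = ∣m-m+n∣≡n x d

edgeLength-left : ∀ y d {x} → x ≡ y + d → edgeLength (x , y) ≡ d
edgeLength-left y d refl = trans (∣-∣-comm (y + d) y) (∣m-m+n∣≡n y d)

index-split : ∀ {i k} → i < k → k ≡ suc (i + (k ∸ suc i))
index-split i<k = sym (m+[n∸m]≡n i<k)

module LeafLengths (m : ℕ) (c K : Affine) where
  private
    C = ⟦ c ⟧ m
    k = ⟦ K ⟧ m

  leafEdgeLength : Leaf → ℕ → ℕ
  leafEdgeLength lf i = edgeLength (C + i , leafVertex m k lf i)

  private
    upward : ∀ {f : ℕ → ℕ} A d → (∀ {i} → i < k → f i ≡ A + d * i) → map f (upTo k) ↭ progression A d k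
    upward {f} A d f≡ = ↭-reflexive (trans (map-upTo f k) (applyUpTo-cong k f≡))

    downward : ∀ {f : ℕ → ℕ} A d → (∀ {i} → i < k → f i ≡ A + d * (k ∸ suc i)) → map f (upTo k) ↭ progression A d k
    downward {f} A d f≡ = ↭-trans (↭-reflexive (trans (map-upTo f k) (applyUpTo-cong k f≡)))
                                   (applyUpTo-reverse-↭ (λ j → A + d * j) k)

  leafLengths-↭ : ∀ lf → OnSide c K lf → map (leafEdgeLength lf) (upTo k) ↭ ⟦ lengthProgression c K lf ⟧ₚ m
  leafLengths-↭ (leaf _ stride₂ right b) c≤b =
    upward D 1 (λ {i} _ → edgeLength-right (C + i) (D + 1 * i) (begin
      ⟦ b ⟧ m + 2 * i      ≡⟨ cong (_+ 2 * i) (⟦⟧-∸ᴬ m c≤b) ⟩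
      C + D + 2 * i        ≡⟨ shuffle C D i ⟩
      C + i + (D + 1 * i)  ∎))
    where
    open ≡-Reasoning
    D = ⟦ b ∸ᴬ c ⟧ m
    shuffle : ∀ C D i → C + D + 2 * i ≡ C + i + (D + 1 * i)
    shuffle = solve-∀
  leafLengths-↭ (leaf _ reversed right b) c+K≤b =
    downward A 2 (λ {i} i<k → edgeLength-right (C + i) (A + 2 * r i) (begin
      B + r i                      ≡⟨ cong (_+ r i) (⟦⟧-∸ᴬ-+ᴬ c K m c+K≤b) ⟩
      C + k + E + r i              ≡⟨ cong (λ k → C + k + E + r i) (index-split i<k) ⟩
      C + suc (i + r i) + E + r i  ≡⟨ shuffle C E i (r i) ⟩
      C + i + (E + 1 + 2 * r i)    ≡⟨ cong (λ a → C + i + (a + 2 * r i)) (sym (⟦⟧-+ᴬ (b ∸ᴬ (c +ᴬ K)) 1ᴬ m)) ⟩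
      C + i + (A + 2 * r i)        ∎))
    where
    open ≡-Reasoning
    B = ⟦ b ⟧ m
    E = ⟦ b ∸ᴬ (c +ᴬ K) ⟧ m
    A = ⟦ b ∸ᴬ (c +ᴬ K) +ᴬ 1ᴬ ⟧ m
    r = λ i → k ∸ suc i
    shuffle : ∀ C E i r → C + suc (i + r) + E + r ≡ C + i + (E + 1 + 2 * r)
    shuffle = solve-∀
  leafLengths-↭ (leaf _ stride₂ left b) b+K≤c =
    downward A 1 (λ {i} i<k → edgeLength-left (B + 2 * i) (A + 1 * r i) (begin
      C + i                          ≡⟨ cong (_+ i) (⟦⟧-∸ᴬ-+ᴬ b K m b+K≤c) ⟩
      B + k + E + i                  ≡⟨ cong (λ k → B + k + E + i) (index-split i<k) ⟩
      B + suc (i + r i) + E + i      ≡⟨ shuffle B E i (r i) ⟩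
      B + 2 * i + (E + 1 + 1 * r i)  ≡⟨ cong (λ a → B + 2 * i + (a + 1 * r i)) (sym (⟦⟧-+ᴬ (c ∸ᴬ (b +ᴬ K)) 1ᴬ m)) ⟩
      B + 2 * i + (A + 1 * r i)      ∎))
    where
    open ≡-Reasoning
    B = ⟦ b ⟧ m
    E = ⟦ c ∸ᴬ (b +ᴬ K) ⟧ m
    A = ⟦ c ∸ᴬ (b +ᴬ K) +ᴬ 1ᴬ ⟧ m
    r = λ i → k ∸ suc i
    shuffle : ∀ B E i r → B + suc (i + r) + E + i ≡ B + 2 * i + (E + 1 + 1 * r)
    shuffle = solve-∀
  leafLengths-↭ (leaf _ reversed left b) b+K≤c =
    upward A 2 (λ {i} i<k → edgeLength-left (B + r i) (A + 2 * i) (begin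
      C + i                      ≡⟨ cong (_+ i) (⟦⟧-∸ᴬ-+ᴬ b K m b+K≤c) ⟩
      B + k + E + i              ≡⟨ cong (λ k → B + k + E + i) (index-split i<k) ⟩
      B + suc (i + r i) + E + i  ≡⟨ shuffle B E i (r i) ⟩
      B + r i + (E + 1 + 2 * i)  ≡⟨ cong (λ a → B + r i + (a + 2 * i)) (sym (⟦⟧-+ᴬ (c ∸ᴬ (b +ᴬ K)) 1ᴬ m)) ⟩
      B + r i + (A + 2 * i)      ∎))
    where
    open ≡-Reasoning
    B = ⟦ b ⟧ m
    E = ⟦ c ∸ᴬ (b +ᴬ K) ⟧ m
    A = ⟦ c ∸ᴬ (b +ᴬ K) +ᴬ 1ᴬ ⟧ m
    r = λ i → k ∸ suc i
    shuffle : ∀ B E i r → B + suc (i + r) + E + i ≡ B + r + (E + 1 + 2 * i)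
    shuffle = solve-∀

Agrees : ∀ {n} → Labelling → ℕ → Family n → Set
Agrees lab m fam = ∀ {i} → i < ⟦ size fam ⟧ m → All (λ lf → lab (familyEdge m fam i lf) ≡ label lf) (toList (leaves fam))

filter-map-agree : ∀ {A : Set} (lab : Edge → Label) (f : A → Edge) (g : A → Label) t {xs} →
  All (λ x → lab (f x) ≡ g x) xs → filter (λ e → lab e ≟L t) (map f xs) ≡ map f (filter (λ x → g x ≟L t) xs)
filter-map-agree lab f g t {[]}     []         = refl
filter-map-agree lab f g t {x ∷ xs} (eq ∷ eqs) with g x ≟L t
... | yes gx≡t = trans (filter-accept (λ e → lab e ≟L t) (trans eq gx≡t)) (cong (f x ∷_) (filter-map-agree lab f g t eqs))
... | no  gx≢t = trans (filter-reject (λ e → lab e ≟L t) (gx≢t ∘ trans (sym eq))) (filter-map-agree lab f g t eqs)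

leavesLabelled : ∀ {n} → Label → Family n → List Leaf
leavesLabelled t fam = filter (λ lf → label lf ≟L t) (toList (leaves fam))

lengthProgressions : ∀ {n} → Label → Family n → List Progression
lengthProgressions t fam = map (lengthProgression (centre fam) (size fam)) (leavesLabelled t fam)

familyLengths-↭ : ∀ {n} m lab t (fam : Family n) →
  Agrees lab m fam → All (OnSide (centre fam) (size fam)) (toList (leaves fam)) →
  map edgeLength (filter (λ e → lab e ≟L t) (concatMap starEdges (familyStars m fam)))
    ↭ concatMap (λ p → ⟦ p ⟧ₚ m) (lengthProgressions t fam)
familyLengths-↭ m lab t fam agrees onSide = begin
  map edgeLength (filter P (concatMap starEdges (map (familyStar m fam) (upTo k))))
    ≡⟨ cong (map edgeLength ∘ filter P) (concatMap-map starEdges (familyStar m fam) (upTo k)) ⟩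
  map edgeLength (filter P (concatMap (starEdges ∘ familyStar m fam) (upTo k)))
    ≡⟨ cong (map edgeLength) (filter-concatMap P (starEdges ∘ familyStar m fam) (upTo k)) ⟩
  map edgeLength (concatMap (filter P ∘ starEdges ∘ familyStar m fam) (upTo k))
    ≡⟨ map-concatMap edgeLength (filter P ∘ starEdges ∘ familyStar m fam) (upTo k) ⟩
  concatMap (map edgeLength ∘ filter P ∘ starEdges ∘ familyStar m fam) (upTo k)
    ≡⟨ concatMap-cong-upTo k starLengths ⟩
  concatMap (λ i → map (λ lf → leafEdgeLength lf i) Lₜ) (upTo k)
    ↭⟨ concatMap-map-comm-↭ (λ i lf → leafEdgeLength lf i) (upTo k) Lₜ ⟩
  concatMap (λ lf → map (leafEdgeLength lf) (upTo k)) Lₜ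
    ↭⟨ concatMap-cong-↭ (AllP.filter⁺ (λ lf → label lf ≟L t) (All.map (λ {lf} → leafLengths-↭ lf) onSide)) ⟩
  concatMap (λ lf → ⟦ lengthProgression (centre fam) (size fam) lf ⟧ₚ m) Lₜ
    ≡⟨ sym (concatMap-map (λ p → ⟦ p ⟧ₚ m) (lengthProgression (centre fam) (size fam)) Lₜ) ⟩
  concatMap (λ p → ⟦ p ⟧ₚ m) (lengthProgressions t fam)
    ∎
  where
  open PermutationReasoning
  open LeafLengths m (centre fam) (size fam)
  k = ⟦ size fam ⟧ m
  P = λ e → lab e ≟L t
  Lₜ = leavesLabelled t fam
  starLengths : ∀ {i} → i < k →
                map edgeLength (filter P (starEdges (familyStar m fam i))) ≡ map (λ lf → leafEdgeLength lf i) Lₜ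
  starLengths {i} i<k = trans (cong (map edgeLength ∘ filter P) (starEdges-familyStar m fam i))
    (trans (cong (map edgeLength) (filter-map-agree lab (familyEdge m fam i) label t (agrees i<k))) (sym (map-∘ Lₜ)))

leafLabels : ∀ {n} → Family n → List Label
leafLabels fam = map label (toList (leaves fam))

familyStar-labels : ∀ {n lab m} (fam : Family n) → Agrees lab m fam → ∀ {i} → i < ⟦ size fam ⟧ m →
                    map lab (starEdges (familyStar m fam i)) ≡ leafLabels fam
familyStar-labels {lab = lab} {m} fam agrees {i} i<k =
  trans (cong (map lab) (starEdges-familyStar m fam i)) (trans (sym (map-∘ _)) (map-cong-local (agrees i<k)))

familyStar-uniform : ∀ {n lab m} (fam : Family n) → Agrees lab m fam → ∀ {i} → i < ⟦ size fam ⟧ m →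
                     ∀ {t} → All (_≡ t) (leafLabels fam) → All (λ e → lab e ≡ t) (starEdges (familyStar m fam i))
familyStar-uniform fam agrees i<k uniform = AllP.map⁻ (subst (All _) (sym (familyStar-labels fam agrees i<k)) uniform)

MixedLabels : List Label → Set
MixedLabels ls = Any (_≡ pure) ls × Any (_≡ prime) ls

mixedLabels? : ∀ ls → Dec (MixedLabels ls)
mixedLabels? ls = any? (_≟L pure) ls ×-dec any? (_≟L prime) ls

IsMixed⇔MixedLabels : ∀ {k} lab (s : Star k) → IsMixed lab s ⇔ MixedLabels (map lab (starEdges s))
IsMixed⇔MixedLabels lab s = mk⇔ (λ (p , q) → AnyP.map⁺ p , AnyP.map⁺ q) (λ (p , q) → AnyP.map⁻ p , AnyP.map⁻ q)

familyStar-mixed⇔ : ∀ {n lab m} (fam : Family n) → Agrees lab m fam → ∀ {i} → i < ⟦ size fam ⟧ m →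
                    IsMixed lab (familyStar m fam i) ⇔ MixedLabels (leafLabels fam)
familyStar-mixed⇔ {lab = lab} {m} fam agrees {i} i<k =
  subst (λ ls → IsMixed lab (familyStar m fam i) ⇔ MixedLabels ls) (familyStar-labels fam agrees i<k) (IsMixed⇔MixedLabels lab _)

mixedCount : ∀ {n} → ℕ → Family n → ℕ
mixedCount m fam with mixedLabels? (leafLabels fam)
... | yes _ = ⟦ size fam ⟧ m
... | no  _ = 0

familyStars-numMixed : ∀ {n lab m} (fam : Family n) → Agrees lab m fam →
                       length (filter (isMixed? lab) (familyStars m fam)) ≡ mixedCount m fam
familyStars-numMixed {lab = lab} {m} fam agrees with mixedLabels? (leafLabels fam)
... | yes mixed = trans (cong length (filter-all (isMixed? lab) allMixed)) (trans (length-map _ (upTo k)) (length-upTo k))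
  where
  k = ⟦ size fam ⟧ m
  allMixed = familyStars-all m fam (λ i<k → Equivalence.from (familyStar-mixed⇔ fam agrees i<k) mixed)
... | no ¬mixed = cong length (filter-none (isMixed? lab) noneMixed)
  where
  noneMixed = familyStars-all m fam (λ i<k → ¬mixed ∘ Equivalence.to (familyStar-mixed⇔ fam agrees i<k))

-- Labelling by a lexicographic threshold

_<ₗₑₓ_ : Edge → ℕ × ℕ → Set
_<ₗₑₓ_ = ×-Lex _≡_ _<_ _<_

_<ₗₑₓ?_ : ∀ e θ → Dec (e <ₗₑₓ θ)
_<ₗₑₓ?_ = ×-decidable _≟_ _<?_ _<?_

thresholdLabelling : ℕ × ℕ → Labelling
thresholdLabelling θ e = if does (e <ₗₑₓ? θ) then pure else prime

-- The second alternatives let the single star centred at T mix labels, split at the leaf S.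
ThresholdLabelled : Affine × Affine → Affine → Affine → Leaf → Set
ThresholdLabelled (T , S) c K (leaf pure  _ _ b) = c +ᴬ K ≤ᴬ T ⊎ (c ≡ T × K ≡ 1ᴬ × b +ᴬ 1ᴬ ≤ᴬ S)
ThresholdLabelled (T , S) c K (leaf prime _ _ b) = T +ᴬ 1ᴬ ≤ᴬ c ⊎ (c ≡ T × K ≡ 1ᴬ × S ≤ᴬ b)

thresholdLabelled? : ∀ θ c K lf → Dec (ThresholdLabelled θ c K lf)
thresholdLabelled? (T , S) c K (leaf pure  _ _ b) = c +ᴬ K ≤ᴬ? T ⊎-dec (c ≟ᴬ T ×-dec K ≟ᴬ 1ᴬ ×-dec b +ᴬ 1ᴬ ≤ᴬ? S)
thresholdLabelled? (T , S) c K (leaf prime _ _ b) = T +ᴬ 1ᴬ ≤ᴬ? c ⊎-dec (c ≟ᴬ T ×-dec K ≟ᴬ 1ᴬ ×-dec S ≤ᴬ? b)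

leafVertex-single : ∀ m lf → leafVertex m 1 lf 0 ≡ ⟦ base lf ⟧ m + 0
leafVertex-single m (leaf _ stride₂  _ _) = refl
leafVertex-single m (leaf _ reversed _ _) = refl

thresholdLabelling-pure : ∀ θ e → e <ₗₑₓ θ → thresholdLabelling θ e ≡ pure
thresholdLabelling-pure θ e e<θ = cong (if_then pure else prime) (dec-true (e <ₗₑₓ? θ) e<θ)

thresholdLabelling-prime : ∀ θ e → ¬ e <ₗₑₓ θ → thresholdLabelling θ e ≡ prime
thresholdLabelling-prime θ e e≮θ = cong (if_then pure else prime) (dec-false (e <ₗₑₓ? θ) e≮θ)

thresholdLabelling-correct : ∀ m T S c K lf → ThresholdLabelled (T , S) c K lf → ∀ {i} → i < ⟦ K ⟧ m →
  thresholdLabelling (⟦ T ⟧ m , ⟦ S ⟧ m) (⟦ c ⟧ m + i , leafVertex m (⟦ K ⟧ m) lf i) ≡ label lf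
thresholdLabelling-correct m T S c K lf@(leaf pure _ _ b) (inj₁ c+K≤T) {i} i<k =
  thresholdLabelling-pure θ e (inj₁ (<-≤-trans (+-monoʳ-< (⟦ c ⟧ m) i<k) c+k≤T))
  where
  θ = ⟦ T ⟧ m , ⟦ S ⟧ m
  e = ⟦ c ⟧ m + i , leafVertex m (⟦ K ⟧ m) lf i
  c+k≤T : ⟦ c ⟧ m + ⟦ K ⟧ m ≤ ⟦ T ⟧ m
  c+k≤T = subst (_≤ ⟦ T ⟧ m) (⟦⟧-+ᴬ c K m) (⟦⟧-mono-≤ m c+K≤T)
thresholdLabelling-correct m T S .T .1ᴬ lf@(leaf pure _ _ b) (inj₂ (refl , refl , b+1≤S)) z<s =
  thresholdLabelling-pure θ e (inj₂ (+-identityʳ _ , subst (_< ⟦ S ⟧ m) (sym (leafVertex-single m lf)) b<S))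
  where
  θ = ⟦ T ⟧ m , ⟦ S ⟧ m
  e = ⟦ T ⟧ m + 0 , leafVertex m 1 lf 0
  b<S : ⟦ b ⟧ m + 0 < ⟦ S ⟧ m
  b<S = subst (_≤ ⟦ S ⟧ m) (trans (⟦⟧-+ᴬ b 1ᴬ m) (trans (+-comm _ 1) (cong suc (sym (+-identityʳ _)))))
              (⟦⟧-mono-≤ m b+1≤S)
thresholdLabelling-correct m T S c K lf@(leaf prime _ _ b) (inj₁ T+1≤c) {i} i<k =
  thresholdLabelling-prime θ e [ <-asym T<c+i , (λ (c+i≡T , _) → <-irrefl (sym c+i≡T) T<c+i) ]
  where
  θ = ⟦ T ⟧ m , ⟦ S ⟧ m
  e = ⟦ c ⟧ m + i , leafVertex m (⟦ K ⟧ m) lf i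
  T<c+i : ⟦ T ⟧ m < ⟦ c ⟧ m + i
  T<c+i = ≤-trans (subst (_≤ ⟦ c ⟧ m) (trans (⟦⟧-+ᴬ T 1ᴬ m) (+-comm _ 1)) (⟦⟧-mono-≤ m T+1≤c)) (m≤m+n _ i)
thresholdLabelling-correct m T S .T .1ᴬ lf@(leaf prime _ _ b) (inj₂ (refl , refl , S≤b)) z<s =
  thresholdLabelling-prime θ e [ (λ T+0<T → <-irrefl (+-identityʳ _) T+0<T) , (λ (_ , v<S) → <⇒≱ v<S S≤v) ]
  where
  θ = ⟦ T ⟧ m , ⟦ S ⟧ m
  e = ⟦ T ⟧ m + 0 , leafVertex m 1 lf 0
  S≤v : ⟦ S ⟧ m ≤ leafVertex m 1 lf 0
  S≤v = subst (⟦ S ⟧ m ≤_) (sym (trans (leafVertex-single m lf) (+-identityʳ _))) (⟦⟧-mono-≤ m S≤b)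

thresholdAgrees : ∀ {n} m T S (fam : Family n) → All (ThresholdLabelled (T , S) (centre fam) (size fam)) (toList (leaves fam)) →
                  Agrees (thresholdLabelling (⟦ T ⟧ m , ⟦ S ⟧ m)) m fam
thresholdAgrees m T S fam labelled i<k =
  All.map (λ {lf} h → thresholdLabelling-correct m T S (centre fam) (size fam) lf h i<k) labelled

ValidFamily : ∀ {n} → Affine × Affine → Family n → Set
ValidFamily θ fam =
  All (λ lf → OnSide (centre fam) (size fam) lf × ThresholdLabelled θ (centre fam) (size fam) lf) (toList (leaves fam))

validFamily? : ∀ {n} θ (fam : Family n) → Dec (ValidFamily θ fam)
validFamily? θ fam =
  All.all? (λ lf → onSide? (centre fam) (size fam) lf ×-dec thresholdLabelled? θ (centre fam) (size fam) lf) _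

realise : ∀ {t} → ℕ → List (Family 5) → Family (t ∸ 1) → AlmostFactor t
realise m fams little = factor (concatMap (familyStars m) fams) (familyStar m little 0)

allVertexProgressions : ∀ {n} → List (Family 5) → Family n → List Progression
allVertexProgressions fams little = concatMap vertexProgressions fams ++ vertexProgressions little

allLengthProgressions : ∀ {n} → Label → List (Family 5) → Family n → List Progression
allLengthProgressions lbl fams little = concatMap (lengthProgressions lbl) fams ++ lengthProgressions lbl little

module _ {t} (m : ℕ) (fams : List (Family 5)) (little : Family (t ∸ 1)) where
  private
    ⟦_⟧ₘ : List Progression → List ℕ
    ⟦_⟧ₘ = concatMap (λ p → ⟦ p ⟧ₚ m)

  littleStar-familyStars : size little ≡ 1ᴬ → ∀ {B : Set} (f : Star (t ∸ 1) → List B) →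
                           f (familyStar m little 0) ≡ concatMap f (familyStars m little)
  littleStar-familyStars single f = trans (sym (++-identityʳ _)) (cong (concatMap f) (sym (familyStars-single m little single)))

  realise-vertices-↭ : size little ≡ 1ᴬ → vertices (realise {t} m fams little) ↭ ⟦ allVertexProgressions fams little ⟧ₘ
  realise-vertices-↭ single = begin
    concatMap starVertices (concatMap (familyStars m) fams) ++ starVertices (familyStar m little 0)
      ≡⟨ cong₂ _++_ (concatMap-concatMap starVertices (familyStars m) fams) (littleStar-familyStars single starVertices) ⟩
    concatMap (concatMap starVertices ∘ familyStars m) fams ++ concatMap starVertices (familyStars m little)
      ↭⟨ ++⁺ (concatMap-cong-↭ {xs = fams} (All.tabulate (λ {fam} _ → familyVertices-↭ m fam))) (familyVertices-↭ m little) ⟩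
    concatMap (⟦_⟧ₘ ∘ vertexProgressions) fams ++ ⟦ vertexProgressions little ⟧ₘ
      ≡⟨ cong (_++ ⟦ vertexProgressions little ⟧ₘ) (sym (concatMap-concatMap _ vertexProgressions fams)) ⟩
    ⟦ concatMap vertexProgressions fams ⟧ₘ ++ ⟦ vertexProgressions little ⟧ₘ
      ≡⟨ sym (concatMap-++ _ (concatMap vertexProgressions fams) _) ⟩
    ⟦ allVertexProgressions fams little ⟧ₘ ∎
    where open PermutationReasoning

  realise-lengths-↭ : size little ≡ 1ᴬ → ∀ lab lbl →
    All (λ fam → Agrees lab m fam × All (OnSide (centre fam) (size fam)) (toList (leaves fam))) fams →
    Agrees lab m little → All (OnSide (centre little) (size little)) (toList (leaves little)) →
    map edgeLength (edgesLabelled lab lbl (realise {t} m fams little)) ↭ ⟦ allLengthProgressions lbl fams little ⟧ₘ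
  realise-lengths-↭ single lab lbl famsOK littleAgrees littleOnSide = begin
    lengths (concatMap starEdges (concatMap (familyStars m) fams) ++ starEdges (familyStar m little 0))
      ≡⟨ lengths-++ (concatMap starEdges (concatMap (familyStars m) fams)) _ ⟩
    lengths (concatMap starEdges (concatMap (familyStars m) fams)) ++ lengths (starEdges (familyStar m little 0))
      ≡⟨ cong₂ _++_ distribute (cong lengths (littleStar-familyStars single starEdges)) ⟩
    concatMap (lengths ∘ concatMap starEdges ∘ familyStars m) fams ++ lengths (concatMap starEdges (familyStars m little))
      ↭⟨ ++⁺ (concatMap-cong-↭ (All.map (λ {fam} (agrees , onSide) → familyLengths-↭ m lab lbl fam agrees onSide) famsOK))
             (familyLengths-↭ m lab lbl little littleAgrees littleOnSide) ⟩
    concatMap (⟦_⟧ₘ ∘ lengthProgressions lbl) fams ++ ⟦ lengthProgressions lbl little ⟧ₘ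
      ≡⟨ cong (_++ ⟦ lengthProgressions lbl little ⟧ₘ) (sym (concatMap-concatMap _ (lengthProgressions lbl) fams)) ⟩
    ⟦ concatMap (lengthProgressions lbl) fams ⟧ₘ ++ ⟦ lengthProgressions lbl little ⟧ₘ
      ≡⟨ sym (concatMap-++ _ (concatMap (lengthProgressions lbl) fams) _) ⟩
    ⟦ allLengthProgressions lbl fams little ⟧ₘ ∎
    where
    open PermutationReasoning
    P = λ e → lab e ≟L lbl
    lengths : List Edge → List ℕ
    lengths = map edgeLength ∘ filter P
    lengths-++ : ∀ xs ys → lengths (xs ++ ys) ≡ lengths xs ++ lengths ys
    lengths-++ xs ys = trans (cong (map edgeLength) (filter-++ P xs ys)) (map-++ edgeLength (filter P xs) (filter P ys))
    distribute : lengths (concatMap starEdges (concatMap (familyStars m) fams))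
                 ≡ concatMap (lengths ∘ concatMap starEdges ∘ familyStars m) fams
    distribute = trans (cong lengths (concatMap-concatMap starEdges (familyStars m) fams))
                 (trans (cong (map edgeLength) (filter-concatMap P _ fams)) (map-concatMap edgeLength _ fams))

  realise-numMixed : ∀ lab → All (Agrees lab m) fams → numMixed lab (realise {t} m fams little) ≡ sum (map (mixedCount m) fams)
  realise-numMixed lab agrees = begin
    length (filter (isMixed? lab) (concatMap (familyStars m) fams))
      ≡⟨ cong length (filter-concatMap (isMixed? lab) (familyStars m) fams) ⟩
    length (concatMap (filter (isMixed? lab) ∘ familyStars m) fams)
      ≡⟨ length-concatMap _ fams ⟩
    sum (map (length ∘ filter (isMixed? lab) ∘ familyStars m) fams)
      ≡⟨ cong sum (map-cong-local (All.map (λ {fam} → familyStars-numMixed fam) agrees)) ⟩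
    sum (map (mixedCount m) fams)
      ∎
    where open ≡-Reasoning

-- Counting differences

labels-partition : ∀ (lab : Labelling) xs → xs ↭ filter (λ e → lab e ≟L pure) xs ++ filter (λ e → lab e ≟L prime) xs
labels-partition lab []       = ↭-refl
labels-partition lab (x ∷ xs) with lab x
... | pure  = prep x (labels-partition lab xs)
... | prime = ↭-trans (prep x (labels-partition lab xs)) (↭-sym (shift x _ _))

forward-if-short : ∀ {g N} e → N + N ≤ g → edgeLength e ≤ N → IsForward g e
forward-if-short e N+N≤g ℓ≤N = m≤n⇒m⊓n≡m (m+n≤o⇒m≤o∸n (edgeLength e) (≤-trans (+-mono-≤ ℓ≤N ℓ≤N) N+N≤g))

length-filter-hasForwardDiff : ∀ g d es → All (IsForward g) es →
                               length (filter (hasForwardDiff? g d) es) ≡ count d (map edgeLength es)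
length-filter-hasForwardDiff g d        []       []           = refl
length-filter-hasForwardDiff g d        (e ∷ es) (fwd ∷ fwds) with edgeLength e ≟ d
length-filter-hasForwardDiff g .(edgeLength e) (e ∷ es) (fwd ∷ fwds) | yes refl =
  trans (cong length (filter-accept (hasForwardDiff? g _) {x = e} {xs = es} (fwd , refl)))
        (trans (cong suc (length-filter-hasForwardDiff g _ es fwds)) (sym (count-here (edgeLength e) (map edgeLength es))))
length-filter-hasForwardDiff g d (e ∷ es) (fwd ∷ fwds) | no ℓ≢d =
  trans (cong length (filter-reject (hasForwardDiff? g d) {x = e} {xs = es} (ℓ≢d ∘ proj₂)))
        (trans (length-filter-hasForwardDiff g d es fwds) (sym (count-there _ ℓ≢d)))

module DifferenceCounting {t} (N g : ℕ) (N+N≤g : N + N ≤ g) (F : AlmostFactor t) (lab : Labelling) (gaps : List ℕ)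
  (pure↭  : map edgeLength (edgesLabelled lab pure F) ↭ range 1 N)
  (prime↭ : map edgeLength (edgesLabelled lab prime F) ++ gaps ↭ range 1 N) where

  private
    E⁺ = edgesLabelled lab pure F
    E⁻ = edgesLabelled lab prime F
    L⁺ = map edgeLength E⁺
    L⁻ = map edgeLength E⁻

    short : All (_≤ N) (range 1 N)
    short = AllP.applyUpTo⁺₁ (1 +_) N (λ i<N → i<N)

    forward⁺ : All (IsForward g) E⁺
    forward⁺ = All.map (λ {e} → forward-if-short e N+N≤g) (AllP.map⁻ (All-resp-↭ (↭-sym pure↭) short))

    forward⁻ : All (IsForward g) E⁻
    forward⁻ = All.map (λ {e} → forward-if-short e N+N≤g) (AllP.map⁻ (AllP.++⁻ˡ L⁻ (All-resp-↭ (↭-sym prime↭) short)))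

    count⁻≤ : ∀ d → count d L⁻ ≤ count d (range 1 N)
    count⁻≤ d = subst (count d L⁻ ≤_) (trans (sym (count-++ d L⁻ gaps)) (count-↭ d prime↭)) (m≤m+n _ _)

    count-range≤1 : ∀ d → count d (range 1 N) ≤ 1
    count-range≤1 d = Unique⇒count≤1 d (range-Unique 1 N)

  allForward : All (IsForward g) (edges F)
  allForward = All-resp-↭ (↭-sym (labels-partition lab (edges F))) (AllP.++⁺ forward⁺ forward⁻)

  numForwardDiff-split : ∀ d → numForwardDiff g d F ≡ count d (range 1 N) + count d L⁻
  numForwardDiff-split d = begin
    numForwardDiff g d F                        ≡⟨ length-filter-hasForwardDiff g d (edges F) allForward ⟩
    count d (map edgeLength (edges F))          ≡⟨ count-↭ d (map⁺ edgeLength (labels-partition lab (edges F))) ⟩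
    count d (map edgeLength (E⁺ ++ E⁻))         ≡⟨ cong (count d) (map-++ edgeLength E⁺ E⁻) ⟩
    count d (L⁺ ++ L⁻)                          ≡⟨ count-++ d L⁺ L⁻ ⟩
    count d L⁺ + count d L⁻                     ≡⟨ cong (_+ count d L⁻) (count-↭ d pure↭) ⟩
    count d (range 1 N) + count d L⁻            ∎
    where open ≡-Reasoning

  covered : ∀ d → 1 ≤ d → d ≤ N → 1 ≤ numForwardDiff g d F
  covered (suc d) _ d<N = subst (1 ≤_) (sym (numForwardDiff-split (suc d)))
    (≤-trans (∈⇒1≤count (AnyP.applyUpTo⁺ (1 +_) refl d<N)) (m≤m+n _ _))

  atMostTwice : ∀ d → numForwardDiff g d F ≤ 2
  atMostTwice d = subst (_≤ 2) (sym (numForwardDiff-split d))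
                        (+-mono-≤ (count-range≤1 d) (≤-trans (count⁻≤ d) (count-range≤1 d)))

  purePrime : IsPurePrimeLabelling g F lab
  purePrime = distinct forward⁺ (λ d → ≤-trans (≤-reflexive (count-↭ d pure↭)) (count-range≤1 d))
            , distinct forward⁻ (λ d → ≤-trans (count⁻≤ d) (count-range≤1 d))
    where
    distinct : ∀ {es} → All (IsForward g) es → (∀ d → count d (map edgeLength es) ≤ 1) → Unique (map (difference g) es)
    distinct fwd count≤1 = subst Unique (sym (map-cong-local fwd)) (count≤1⇒Unique _ count≤1)

-- The construction for g = 30m + 27

starFamilies : List (Family 5)
starFamilies =
    family (1 , 0) (1 , 0)
      (leaf pure  reversed left  (0 , 0)
      ∷ leaf pure  reversed right (2 , 1)
      ∷ leaf pure  stride₂  right (5 , 5)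
      ∷ leaf pure  stride₂  right (7 , 6)
      ∷ leaf pure  stride₂  right (10 , 10)
      ∷ [])
  ∷ family (9 , 8) (1 , 0)
      (leaf pure  stride₂  left  (3 , 3)
      ∷ leaf pure  stride₂  right (12 , 12)
      ∷ leaf pure  stride₂  right (16 , 16)
      ∷ leaf pure  stride₂  right (20 , 20)
      ∷ leaf pure  stride₂  right (22 , 22)
      ∷ [])
  ∷ family (14 , 13) (1 , 0)
      (leaf pure  stride₂  left  (3 , 2)
      ∷ leaf pure  stride₂  left  (5 , 6)
      ∷ leaf pure  stride₂  right (16 , 17)
      ∷ leaf pure  stride₂  right (26 , 27)
      ∷ leaf pure  stride₂  right (28 , 27)
      ∷ [])
  ∷ family (15 , 14) (1 , 0)
      (leaf prime stride₂  left  (10 , 11)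
      ∷ leaf prime stride₂  right (22 , 21)
      ∷ leaf prime stride₂  right (24 , 25)
      ∷ leaf prime stride₂  right (26 , 28)
      ∷ leaf prime stride₂  right (28 , 28)
      ∷ [])
  ∷ family (18 , 17) (1 , 0)
      (leaf prime reversed right (19 , 18)
      ∷ leaf prime stride₂  left  (7 , 7)
      ∷ leaf prime stride₂  left  (12 , 13)
      ∷ leaf prime stride₂  right (20 , 19)
      ∷ leaf prime stride₂  right (24 , 24)
      ∷ [])
  ∷ family (12 , 10) (0 , 1)
      (leaf pure  stride₂  left  (10 , 9)
      ∷ leaf pure  stride₂  left  (2 , 0)
      ∷ leaf pure  stride₂  left  (7 , 5)
      ∷ leaf pure  stride₂  right (24 , 23)
      ∷ leaf pure  stride₂  right (19 , 17)
      ∷ [])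
  ∷ family (14 , 12) (0 , 1)
      (leaf pure  stride₂  right (16 , 15)
      ∷ leaf pure  stride₂  left  (10 , 8)
      ∷ leaf pure  stride₂  right (16 , 14)
      ∷ leaf pure  stride₂  left  (5 , 3)
      ∷ leaf pure  stride₂  left  (5 , 4)
      ∷ [])
  ∷ family (15 , 13) (0 , 1)
      (leaf pure  stride₂  left  (3 , 1)
      ∷ leaf pure  stride₂  right (22 , 19)
      ∷ leaf pure  stride₂  left  (5 , 2)
      ∷ leaf prime stride₂  right (26 , 26)
      ∷ leaf prime stride₂  right (26 , 25)
      ∷ [])
  ∷ family (18 , 16) (0 , 1)
      (leaf prime stride₂  right (24 , 22)
      ∷ leaf prime stride₂  left  (12 , 11)
      ∷ leaf prime stride₂  left  (9 , 6)
      ∷ leaf prime stride₂  right (26 , 24)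
      ∷ leaf prime stride₂  left  (9 , 7)
      ∷ [])
  ∷ []

littleFamily : Family 2
littleFamily = family (24 , 21) (0 , 1)
    (leaf prime stride₂  left  (20 , 18)
    ∷ leaf prime stride₂  left  (22 , 20)
    ∷ [])

vertexTiling : Tiling 0ᴬ (30 , 27)
vertexTiling =
  run (1 , 0) ∷ run (1 , 0) ∷ point 2 ∷ run (1 , 0) ∷ point 2 ∷ twin (1 , 0)
  ∷ point 2 ∷ point 2 ∷ point 2 ∷ twin (1 , 0) ∷ point 2 ∷ twin (1 , 0)
  ∷ point 2 ∷ point 2 ∷ run (1 , 0) ∷ point 2 ∷ point 2 ∷ twin (1 , 0)
  ∷ run (0 , 1) ∷ point 2 ∷ twin (1 , 0) ∷ run (0 , 1) ∷ run (1 , 0) ∷ run (0 , 1)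
  ∷ run (1 , 0) ∷ point 2 ∷ point 2 ∷ twin (1 , 0) ∷ run (0 , 1) ∷ run (1 , 0)
  ∷ point 2 ∷ run (1 , 0) ∷ point 2 ∷ twin (1 , 0) ∷ point 2 ∷ point 2
  ∷ twin (1 , 0) ∷ run (0 , 1) ∷ point 2 ∷ point 2 ∷ twin (1 , 0) ∷ point 2
  ∷ point 2 ∷ point 2 ∷ twin (1 , 0) ∷ twin (1 , 0) ∷ []

pureTiling : Tiling 1ᴬ (15 , 13)
pureTiling =
  twin (1 , 0) ∷ run (0 , 1) ∷ run (0 , 1) ∷ run (0 , 1) ∷ run (1 , 0) ∷ run (1 , 0)
  ∷ run (0 , 1) ∷ run (1 , 0) ∷ run (0 , 1) ∷ run (1 , 0) ∷ run (1 , 0) ∷ run (0 , 1)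
  ∷ run (0 , 1) ∷ run (1 , 0) ∷ run (1 , 0) ∷ run (0 , 1) ∷ run (0 , 1) ∷ run (1 , 0)
  ∷ run (0 , 1) ∷ run (0 , 1) ∷ run (1 , 0) ∷ run (1 , 0) ∷ run (0 , 1) ∷ run (0 , 1)
  ∷ run (1 , 0) ∷ run (1 , 0) ∷ run (1 , 0) ∷ []

primeTiling : Tiling 1ᴬ (15 , 13)
primeTiling =
  twin (1 , 0) ∷ run (0 , 1) ∷ run (1 , 0) ∷ run (1 , 1) ∷ run (0 , 1) ∷ run (1 , 0)
  ∷ run (0 , 1) ∷ run (1 , 0) ∷ run (0 , 1) ∷ run (0 , 1) ∷ run (1 , 0) ∷ run (1 , 0)
  ∷ run (0 , 1) ∷ run (0 , 1) ∷ run (1 , 0) ∷ run (0 , 1) ∷ run (0 , 1) ∷ run (1 , 0)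
  ∷ run (1 , 0) ∷ run (0 , 1) ∷ run (0 , 1) ∷ run (0 , 1) ∷ run (1 , 0) ∷ run (1 , 0)
  ∷ run (1 , 0) ∷ run (1 , 0) ∷ []

primeGaps : List Progression
primeGaps =
  prog (0 , 1) 2 (1 , 0) ∷ prog (3 , 2) 1 (1 , 1) ∷ prog (5 , 4) 1 (0 , 1) ∷ prog (8 , 7) 1 (0 , 1)
  ∷ prog (8 , 9) 1 (1 , 0) ∷ prog (11 , 11) 1 (0 , 1) ∷ prog (12 , 14) 1 (1 , 0) ∷ prog (14 , 14) 1 (1 , 0) ∷ []

threshold : Affine × Affine
threshold = (15 , 13) , (26 , 25)

families-valid : All (ValidFamily threshold) starFamilies × ValidFamily threshold littleFamily
families-valid = from-yes (All.all? (validFamily? threshold) starFamilies ×-dec validFamily? threshold littleFamily)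

vertexProgressions-↭ : allVertexProgressions starFamilies littleFamily ↭ tiles vertexTiling
vertexProgressions-↭ = from-just (searchPermutation (allVertexProgressions starFamilies littleFamily) (tiles vertexTiling))

pureProgressions-↭ : allLengthProgressions pure starFamilies littleFamily ↭ tiles pureTiling
pureProgressions-↭ = from-just (searchPermutation (allLengthProgressions pure starFamilies littleFamily) (tiles pureTiling))

primeProgressions-↭ : allLengthProgressions prime starFamilies littleFamily ++ primeGaps ↭ tiles primeTiling
primeProgressions-↭ =
  from-just (searchPermutation (allLengthProgressions prime starFamilies littleFamily ++ primeGaps) (tiles primeTiling))

mixedCount-starFamilies : ∀ m → sum (map (mixedCount m) starFamilies) ≡ 1
mixedCount-starFamilies m = refl

construction : ℕ → AlmostFactor 3
construction m = realise m starFamilies littleFamily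

labelling : ℕ → Labelling
labelling m = thresholdLabelling (⟦ proj₁ threshold ⟧ m , ⟦ proj₂ threshold ⟧ m)

module _ (m : ℕ) where
  private
    ⟦_⟧ₘ : List Progression → List ℕ
    ⟦_⟧ₘ = concatMap (λ p → ⟦ p ⟧ₚ m)

    placed : ∀ {n} {fam : Family n} → ValidFamily threshold fam →
             Agrees (labelling m) m fam × All (OnSide (centre fam) (size fam)) (toList (leaves fam))
    placed {fam = fam} valid =
      thresholdAgrees m (proj₁ threshold) (proj₂ threshold) fam (All.map proj₂ valid) , All.map proj₁ valid

    starFamilies-placed = All.map placed (proj₁ families-valid)
    littleFamily-placed = placed (proj₂ families-valid)

    lengths-↭ : ∀ lbl → map edgeLength (edgesLabelled (labelling m) lbl (construction m))
                        ↭ ⟦ allLengthProgressions lbl starFamilies littleFamily ⟧ₘ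
    lengths-↭ lbl = realise-lengths-↭ {3} m starFamilies littleFamily refl (labelling m) lbl starFamilies-placed
                                      (proj₁ littleFamily-placed) (proj₂ littleFamily-placed)

  construction-vertices : IsAlmost5StarFactor (30 * m + 27) 3 (construction m)
  construction-vertices = ↭-trans (realise-vertices-↭ {3} m starFamilies littleFamily refl)
                                  (↭-trans (concatMap⁺ (λ p → ⟦ p ⟧ₚ m) vertexProgressions-↭) (tiling-↭ m vertexTiling))

  construction-pureLengths : map edgeLength (edgesLabelled (labelling m) pure (construction m)) ↭ range 1 (15 * m + 13)
  construction-pureLengths =
    ↭-trans (lengths-↭ pure) (↭-trans (concatMap⁺ (λ p → ⟦ p ⟧ₚ m) pureProgressions-↭) (tiling-↭ m pureTiling))

  construction-primeLengths : map edgeLength (edgesLabelled (labelling m) prime (construction m)) ++ ⟦ primeGaps ⟧ₘ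
                              ↭ range 1 (15 * m + 13)
  construction-primeLengths = begin
    map edgeLength (edgesLabelled (labelling m) prime (construction m)) ++ ⟦ primeGaps ⟧ₘ
      ↭⟨ ++⁺ʳ ⟦ primeGaps ⟧ₘ (lengths-↭ prime) ⟩
    ⟦ allLengthProgressions prime starFamilies littleFamily ⟧ₘ ++ ⟦ primeGaps ⟧ₘ
      ≡⟨ sym (concatMap-++ (λ p → ⟦ p ⟧ₚ m) (allLengthProgressions prime starFamilies littleFamily) primeGaps) ⟩
    ⟦ allLengthProgressions prime starFamilies littleFamily ++ primeGaps ⟧ₘ
      ↭⟨ concatMap⁺ (λ p → ⟦ p ⟧ₚ m) primeProgressions-↭ ⟩
    ⟦ tiles primeTiling ⟧ₘ
      ↭⟨ tiling-↭ m primeTiling ⟩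
    range 1 (15 * m + 13) ∎
    where open PermutationReasoning

  construction-numMixed : numMixed (labelling m) (construction m) ≡ 1
  construction-numMixed = trans (realise-numMixed {3} m starFamilies littleFamily (labelling m) (All.map proj₁ starFamilies-placed))
                                (mixedCount-starFamilies m)

  construction-littleStar : IsPrimeStar (labelling m) (littleStar (construction m))
  construction-littleStar = familyStar-uniform littleFamily (proj₁ littleFamily-placed) z<s (refl ∷ refl ∷ [])

lemma3p2 : (m : ℕ) →
    Σ (AlmostFactor 3) λ F →
      IsAlmost5StarFactor (30 * m + 27) 3 F
      × (∀ d → 1 ≤ d → d ≤ 15 * m + 13 → 1 ≤ numForwardDiff (30 * m + 27) d F)
      × (∀ d → 1 ≤ d → d ≤ 15 * m + 13 → numForwardDiff (30 * m + 27) d F ≤ 2)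
      × All (IsForward (30 * m + 27)) (edges F)
      × Σ Labelling λ lab →
          IsPurePrimeLabelling (30 * m + 27) F lab
          × numMixed lab F ≡ 1
          × IsPrimeStar lab (littleStar F)
lemma3p2 m =
  construction m , construction-vertices m , covered , (λ d _ _ → atMostTwice d) , allForward ,
  labelling m , purePrime , construction-numMixed m , construction-littleStar m
  where
  N+N≤g : 15 * m + 13 + (15 * m + 13) ≤ 30 * m + 27
  N+N≤g = subst (15 * m + 13 + (15 * m + 13) ≤_) (double+1 m) (n≤1+n _)
    where
    double+1 : ∀ m → suc (15 * m + 13 + (15 * m + 13)) ≡ 30 * m + 27
    double+1 = solve-∀
  open DifferenceCounting (15 * m + 13) (30 * m + 27) N+N≤g (construction m) (labelling m) _
                          (construction-pureLengths m) (construction-primeLengths m)
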